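{- Let $a$ be an odd positive integer and, for integers $j$, let $\lambda_j=\left\lfloor\frac{j^2}{a}\right\rfloor$. Then the square Frobenius number $r_2(a,a+2)$ equals $(a-j_1)^2$, where $j_1$ is the smallest integer $j$ with $1\le j<a$ such that at least one of the following holds: (1) $j^2 \bmod a$ is even and $(j+2)^2>(\lambda_j+2)(a+2)$; (2) $j^2 \bmod a$ is odd and $(j+2)^2>(\lambda_j+1)(a+2)$.
   Context: For coprime positive integers $m,n$, $r_2(m,n)$ denotes the largest perfect square that cannot be written as $mx+ny$ with $x,y$ nonnegative integers. Here $j^2 \bmod a$ denotes the remainder of $j^2$ upon division by $a$, in $\{0,\ldots,a-1\}$. -}

module Defs where

open import Data.Nat using (ℕ; zero; suc; _+_; _*_; _∸_; _^_; _≤_; _<_; NonZero)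
open import Data.Nat.DivMod using (_/_; _%_)
open import Data.Product using (Σ; ∃; _×_; _,_)
open import Data.Sum using (_⊎_)
open import Relation.Nullary using (¬_)
open import Relation.Binary.PropositionalEquality using (_≡_)

Rep : ℕ → ℕ → ℕ → Set
Rep m n s = ∃ λ x → ∃ λ y → m * x + n * y ≡ s

IsSquareFrobenius : ℕ → ℕ → ℕ → Set
IsSquareFrobenius m n r =
  (∃ λ k → r ≡ k ^ 2) × ¬ Rep m n r × (∀ k → r < k ^ 2 → Rep m n (k ^ 2))

lam : (a : ℕ) → .{{_ : NonZero a}} → ℕ → ℕ
lam a j = (j ^ 2) / a

Cond : (a : ℕ) → .{{_ : NonZero a}} → ℕ → Set
Cond a j =
  ((j ^ 2 % a) % 2 ≡ 0 × (lam a j + 2) * (a + 2) < (j + 2) ^ 2)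
  ⊎ ((j ^ 2 % a) % 2 ≡ 1 × (lam a j + 1) * (a + 2) < (j + 2) ^ 2)

IsJ1 : (a : ℕ) → .{{_ : NonZero a}} → ℕ → Set
IsJ1 a j = 1 ≤ j × j < a × Cond a j × (∀ i → 1 ≤ i → i < j → ¬ Cond a i)

{-# OPTIONS --safe #-}
module Submission where

-- Since a * x + (a + 2) * y = (x + y) * a + 2 * y, a number s = ρ + T * a with ρ < a is
-- representable iff the least y with 2 * y ≡ ρ (mod a), namely ρ / 2 or (ρ + a) / 2,
-- leaves room for it: y ≤ T, respectively y + 1 ≤ T.  For k + j = a the squares k² and j²
-- have the same residue mod a and ⌊k²/a⌋ + 2j = ⌊j²/a⌋ + a, which turns this criterion
-- for k² into the negation of conditions (1)/(2) for j.  So (a - j₁)² is not representable,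
-- while a larger square k² is: either k ≥ a, whence ⌊k²/a⌋ ≥ a, or a - k < j₁ fails both
-- conditions.

open import Defs
open import Data.List using (_∷_; [])
open import Data.Nat using (ℕ; zero; suc; s≤s; _+_; _*_; _∸_; _^_; _≤_; _<_; NonZero; _≤?_)
open import Data.Nat.Properties
open import Data.Nat.DivMod
  using (_%_; _/_; m≡m%n+[m/n]*n; m%n<n; [m+kn]%n≡m%n; m*n/n≡m; /-monoˡ-≤; +-distrib-/-∣ʳ)
open import Data.Nat.Divisibility using (n∣m*n)
open import Data.Nat.Tactic.RingSolver using (solve)
open import Data.Product using (∃; ∃₂; _×_; _,_; proj₁; proj₂)
open import Data.Sum using (_⊎_; inj₁; inj₂)
open import Function.Base using (_∘_)
open import Function.Bundles using (_⇔_; mk⇔; Equivalence)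
import Function.Properties.Equivalence as ⇔
open import Relation.Nullary using (¬_; yes; no; contradiction)
open import Relation.Binary.PropositionalEquality

n^2≡n*n : ∀ n → n ^ 2 ≡ n * n
n^2≡n*n n = cong (n *_) (*-identityʳ n)

m%2≡0⊎m%2≡1 : ∀ m → m % 2 ≡ 0 ⊎ m % 2 ≡ 1
m%2≡0⊎m%2≡1 m with m % 2 | m%n<n m 2
... | 0           | _               = inj₁ refl
... | 1           | _               = inj₂ refl
... | suc (suc _) | s≤s (s≤s ())

m%2≡0⇒m≡2[m/2] : ∀ m → m % 2 ≡ 0 → m ≡ 2 * (m / 2)
m%2≡0⇒m≡2[m/2] m even =
  trans (m≡m%n+[m/n]*n m 2) (trans (cong (_+ m / 2 * 2) even) (*-comm (m / 2) 2))

m%2≡1⇒m≡1+2[m/2] : ∀ m → m % 2 ≡ 1 → m ≡ suc (2 * (m / 2))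
m%2≡1⇒m≡1+2[m/2] m odd =
  trans (m≡m%n+[m/n]*n m 2) (trans (cong (_+ m / 2 * 2) odd) (cong suc (*-comm (m / 2) 2)))

odd<odd⇒2+m≤n : ∀ {m n} → m % 2 ≡ 1 → n % 2 ≡ 1 → m < n → 2 + m ≤ n
odd<odd⇒2+m≤n {m} {n} m-odd n-odd m<n = ≤∧≢⇒< m<n λ 1+m≡n →
  even≢odd (suc (m / 2)) (n / 2) (begin
    2 * suc (m / 2)         ≡⟨ *-suc 2 (m / 2) ⟩
    suc (suc (2 * (m / 2))) ≡⟨ cong suc (sym (m%2≡1⇒m≡1+2[m/2] m m-odd)) ⟩
    suc m                   ≡⟨ 1+m≡n ⟩
    n                       ≡⟨ m%2≡1⇒m≡1+2[m/2] n n-odd ⟩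
    suc (2 * (n / 2))       ∎)
  where open ≡-Reasoning

+-cross-< : ∀ {m n o p} → m + n ≡ o + p → m < p ⇔ o < n
+-cross-< {m} {n} {o} {p} m+n≡o+p = mk⇔
  (λ m<p → +-cancelʳ-< p o n (begin-strict
    o + p ≡⟨ sym m+n≡o+p ⟩
    m + n <⟨ +-monoˡ-< n m<p ⟩
    p + n ≡⟨ +-comm p n ⟩
    n + p ∎))
  (λ o<n → +-cancelʳ-< n m p (begin-strict
    m + n ≡⟨ m+n≡o+p ⟩
    o + p <⟨ +-monoˡ-< p o<n ⟩
    n + p ≡⟨ +-comm n p ⟩
    p + n ∎))
  where open ≤-Reasoning

-- The fewest copies of a + 2 in a representation of ρ + T * a (ρ < a) are ρ / 2 for even ρ
-- and (ρ + a) / 2 for odd ρ; the rest must be a nonnegative multiple of a.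
RepCond : ℕ → ℕ → ℕ → Set
RepCond a ρ T = (ρ % 2 ≡ 0 × ρ ≤ 2 * T) ⊎ (ρ % 2 ≡ 1 × ρ + a + 2 ≤ 2 * T)

Rep-intro : ∀ {a ρ T} y e → 2 * y ≡ e * a + ρ → e + y ≤ T → Rep a (a + 2) (ρ + T * a)
Rep-intro {a} {ρ} {T} y e 2y≡ea+ρ e+y≤T with m≤n⇒∃[o]m+o≡n e+y≤T
... | x , e+y+x≡T = x , y , (begin
  a * x + (a + 2) * y       ≡⟨ solve (a ∷ x ∷ y ∷ []) ⟩
  a * (x + y) + 2 * y       ≡⟨ cong (a * (x + y) +_) 2y≡ea+ρ ⟩
  a * (x + y) + (e * a + ρ) ≡⟨ solve (a ∷ x ∷ y ∷ e ∷ ρ ∷ []) ⟩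
  ρ + (e + y + x) * a       ≡⟨ cong (λ t → ρ + t * a) e+y+x≡T ⟩
  ρ + T * a                 ∎)
  where open ≡-Reasoning

RepCond⇒Rep : ∀ {a ρ T} → a % 2 ≡ 1 → RepCond a ρ T → Rep a (a + 2) (ρ + T * a)
RepCond⇒Rep {a} {ρ} {T} _ (inj₁ (ρ-even , ρ≤2T)) =
  Rep-intro {a} {ρ} {T} (ρ / 2) 0 (sym (m%2≡0⇒m≡2[m/2] ρ ρ-even))
    (*-cancelˡ-≤ 2 (≤-trans (≤-reflexive (sym (m%2≡0⇒m≡2[m/2] ρ ρ-even))) ρ≤2T))
RepCond⇒Rep {a} {ρ} {T} a-odd (inj₂ (ρ-odd , ρ+a+2≤2T)) =
  Rep-intro {a} {ρ} {T} y 1 (trans (sym ρ+a≡2y) (solve (ρ ∷ a ∷ [])))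
    (*-cancelˡ-≤ 2 (≤-trans (≤-reflexive 2[1+y]≡ρ+a+2) ρ+a+2≤2T))
  where
  open ≡-Reasoning
  y : ℕ
  y = suc (ρ / 2 + a / 2)
  ρ+a≡2y : ρ + a ≡ 2 * y
  ρ+a≡2y = begin
    ρ + a                                 ≡⟨ cong₂ _+_ (m%2≡1⇒m≡1+2[m/2] ρ ρ-odd) (m%2≡1⇒m≡1+2[m/2] a a-odd) ⟩
    suc (2 * (ρ / 2)) + suc (2 * (a / 2)) ≡⟨ odd+odd (ρ / 2) (a / 2) ⟩
    2 * y                                 ∎
    where
    odd+odd : ∀ h b → suc (2 * h) + suc (2 * b) ≡ 2 * suc (h + b)
    odd+odd h b = solve (h ∷ b ∷ [])
  2[1+y]≡ρ+a+2 : 2 * (1 + y) ≡ ρ + a + 2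
  2[1+y]≡ρ+a+2 = trans (*-suc 2 y) (trans (+-comm 2 (2 * y)) (cong (_+ 2) (sym ρ+a≡2y)))

Rep⇒excess : ∀ {a ρ T} → ρ < a → Rep a (a + 2) (ρ + T * a) →
  ∃₂ λ d y → 2 * y ≡ d * a + ρ × d * (a + 2) + ρ ≤ 2 * T
Rep⇒excess {a} {ρ} {T} ρ<a (x , y , ax+[a+2]y≡s) = excess (m≤n⇒∃[o]m+o≡n x+y≤T)
  where
  open ≡-Reasoning
  weight : (x + y) * a + 2 * y ≡ ρ + T * a
  weight = trans regroup ax+[a+2]y≡s
    where
    regroup : (x + y) * a + 2 * y ≡ a * x + (a + 2) * y
    regroup = solve (a ∷ x ∷ y ∷ [])
  x+y≤T : x + y ≤ T
  x+y≤T = ≮⇒≥ λ T<x+y → <⇒≱ ρ<a (+-cancelʳ-≤ (T * a) a ρ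
    (≤-trans (*-monoˡ-≤ a T<x+y) (≤-trans (m≤m+n _ (2 * y)) (≤-reflexive weight))))
  excess : ∃ (λ d → x + y + d ≡ T) → ∃₂ λ d y → 2 * y ≡ d * a + ρ × d * (a + 2) + ρ ≤ 2 * T
  excess (d , x+y+d≡T) = d , y , 2y≡da+ρ , ≤-trans (m≤n+m _ (2 * x)) (≤-reflexive (sym 2T≡2x+d[a+2]+ρ))
    where
    2y≡da+ρ : 2 * y ≡ d * a + ρ
    2y≡da+ρ = +-cancelˡ-≡ ((x + y) * a) (2 * y) (d * a + ρ) (begin
      (x + y) * a + 2 * y       ≡⟨ weight ⟩
      ρ + T * a                 ≡⟨ cong (λ t → ρ + t * a) (sym x+y+d≡T) ⟩
      ρ + (x + y + d) * a       ≡⟨ solve (ρ ∷ x ∷ y ∷ d ∷ a ∷ []) ⟩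
      (x + y) * a + (d * a + ρ) ∎)
    2T≡2x+d[a+2]+ρ : 2 * T ≡ 2 * x + (d * (a + 2) + ρ)
    2T≡2x+d[a+2]+ρ = begin
      2 * T                       ≡⟨ cong (2 *_) (sym x+y+d≡T) ⟩
      2 * (x + y + d)             ≡⟨ solve (x ∷ y ∷ d ∷ []) ⟩
      2 * x + 2 * d + 2 * y       ≡⟨ cong (2 * x + 2 * d +_) 2y≡da+ρ ⟩
      2 * x + 2 * d + (d * a + ρ) ≡⟨ solve (x ∷ d ∷ a ∷ ρ ∷ []) ⟩
      2 * x + (d * (a + 2) + ρ)   ∎

Rep⇒RepCond : ∀ {a ρ T} → ρ < a → Rep a (a + 2) (ρ + T * a) → RepCond a ρ T
Rep⇒RepCond {a} {ρ} {T} ρ<a rep with Rep⇒excess {a} {ρ} {T} ρ<a rep | m%2≡0⊎m%2≡1 ρ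
... | _ , _ , _ , bound | inj₁ ρ-even = inj₁ (ρ-even , ≤-trans (m≤n+m ρ _) bound)
... | zero , y , 2y≡ρ , _ | inj₂ ρ-odd =
  contradiction (trans 2y≡ρ (m%2≡1⇒m≡1+2[m/2] ρ ρ-odd)) (even≢odd y (ρ / 2))
... | suc d , _ , _ , bound | inj₂ ρ-odd = inj₂ (ρ-odd , (begin
  ρ + a + 2           ≡⟨ solve (ρ ∷ a ∷ []) ⟩
  (a + 2) + ρ         ≤⟨ +-monoˡ-≤ ρ (m≤m+n (a + 2) (d * (a + 2))) ⟩
  suc d * (a + 2) + ρ ≤⟨ bound ⟩
  2 * T               ∎))
  where open ≤-Reasoning

Rep⇔RepCond : ∀ {a} .{{_ : NonZero a}} → a % 2 ≡ 1 →
  ∀ s → Rep a (a + 2) s ⇔ RepCond a (s % a) (s / a)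
Rep⇔RepCond {a} a-odd s = mk⇔
  (λ rep → Rep⇒RepCond {a} {s % a} {s / a} (m%n<n s a) (subst (Rep a (a + 2)) s≡ρ+Ta rep))
  (λ cond → subst (Rep a (a + 2)) (sym s≡ρ+Ta) (RepCond⇒Rep {a} {s % a} {s / a} a-odd cond))
  where
  s≡ρ+Ta : s ≡ s % a + s / a * a
  s≡ρ+Ta = m≡m%n+[m/n]*n s a

a≤T⇒RepCond : ∀ {a ρ T} → a % 2 ≡ 1 → ρ < a → a ≤ T → RepCond a ρ T
a≤T⇒RepCond {a} {ρ} {T} a-odd ρ<a a≤T with m%2≡0⊎m%2≡1 ρ
... | inj₁ ρ-even = inj₁ (ρ-even , ≤-trans (<⇒≤ ρ<a) (≤-trans a≤T (m≤n*m T 2)))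
... | inj₂ ρ-odd  = inj₂ (ρ-odd , (begin
  ρ + a + 2   ≡⟨ solve (ρ ∷ a ∷ []) ⟩
  (2 + ρ) + a ≤⟨ +-monoˡ-≤ a (odd<odd⇒2+m≤n ρ-odd a-odd ρ<a) ⟩
  a + a       ≡⟨ solve (a ∷ []) ⟩
  2 * a       ≤⟨ *-monoʳ-≤ 2 a≤T ⟩
  2 * T       ∎))
  where open ≤-Reasoning

a≤k⇒Rep[k²] : ∀ {a} .{{_ : NonZero a}} → a % 2 ≡ 1 → ∀ {k} → a ≤ k → Rep a (a + 2) (k ^ 2)
a≤k⇒Rep[k²] {a} a-odd {k} a≤k =
  Equivalence.from (Rep⇔RepCond a-odd (k ^ 2)) (a≤T⇒RepCond a-odd (m%n<n (k ^ 2) a) a≤k²/a)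
  where
  open ≤-Reasoning
  a≤k²/a : a ≤ k ^ 2 / a
  a≤k²/a = begin
    a         ≡⟨ sym (m*n/n≡m a a) ⟩
    a * a / a ≤⟨ /-monoˡ-≤ a (*-mono-≤ a≤k a≤k) ⟩
    k * k / a ≡⟨ cong (_/ a) (sym (n^2≡n*n k)) ⟩
    k ^ 2 / a ∎

square-complement : ∀ k j {a} → k + j ≡ a → k ^ 2 + 2 * j * a ≡ j ^ 2 + a * a
square-complement k j refl rewrite n^2≡n*n k | n^2≡n*n j = solve (k ∷ j ∷ [])

square-complement-% : ∀ {a} .{{_ : NonZero a}} k j → k + j ≡ a → k ^ 2 % a ≡ j ^ 2 % a
square-complement-% {a} k j k+j≡a = begin
  k ^ 2 % a               ≡⟨ sym ([m+kn]%n≡m%n (k ^ 2) (2 * j) a) ⟩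
  (k ^ 2 + 2 * j * a) % a ≡⟨ cong (_% a) (square-complement k j k+j≡a) ⟩
  (j ^ 2 + a * a) % a     ≡⟨ [m+kn]%n≡m%n (j ^ 2) a a ⟩
  j ^ 2 % a               ∎
  where open ≡-Reasoning

square-complement-/ : ∀ {a} .{{_ : NonZero a}} k j → k + j ≡ a → k ^ 2 / a + 2 * j ≡ j ^ 2 / a + a
square-complement-/ {a} k j k+j≡a = begin
  k ^ 2 / a + 2 * j         ≡⟨ cong (k ^ 2 / a +_) (sym (m*n/n≡m (2 * j) a)) ⟩
  k ^ 2 / a + 2 * j * a / a ≡⟨ sym (+-distrib-/-∣ʳ (k ^ 2) (n∣m*n (2 * j))) ⟩
  (k ^ 2 + 2 * j * a) / a   ≡⟨ cong (_/ a) (square-complement k j k+j≡a) ⟩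
  (j ^ 2 + a * a) / a       ≡⟨ +-distrib-/-∣ʳ (j ^ 2) (n∣m*n a) ⟩
  j ^ 2 / a + a * a / a     ≡⟨ cong (j ^ 2 / a +_) (m*n/n≡m a a) ⟩
  j ^ 2 / a + a             ∎
  where open ≡-Reasoning

cond-identities : ∀ a j ρ l T → j ^ 2 ≡ ρ + l * a → T + 2 * j ≡ l + a →
  (l + 2) * (a + 2) + ρ ≡ 2 * T + (j + 2) ^ 2 ×
  (l + 1) * (a + 2) + (ρ + a + 2) ≡ 2 * T + (j + 2) ^ 2
cond-identities a j ρ l T j²≡ρ+la T+2j≡l+a =
  (begin
    (l + 2) * (a + 2) + ρ       ≡⟨ solve (l ∷ a ∷ ρ ∷ []) ⟩
    ρ + l * a + 2 * (l + a) + 4 ≡⟨ pivot ⟩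
    2 * T + (j + 2) ^ 2         ∎) ,
  (begin
    (l + 1) * (a + 2) + (ρ + a + 2) ≡⟨ solve (l ∷ a ∷ ρ ∷ []) ⟩
    ρ + l * a + 2 * (l + a) + 4     ≡⟨ pivot ⟩
    2 * T + (j + 2) ^ 2             ∎)
  where
  open ≡-Reasoning
  pivot : ρ + l * a + 2 * (l + a) + 4 ≡ 2 * T + (j + 2) ^ 2
  pivot = begin
    ρ + l * a + 2 * (l + a) + 4 ≡⟨ cong₂ (λ u v → u + 2 * v + 4) (sym j²≡ρ+la) (sym T+2j≡l+a) ⟩
    j ^ 2 + 2 * (T + 2 * j) + 4 ≡⟨ cong (λ u → u + 2 * (T + 2 * j) + 4) (n^2≡n*n j) ⟩
    j * j + 2 * (T + 2 * j) + 4 ≡⟨ solve (j ∷ T ∷ []) ⟩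
    2 * T + (j + 2) * (j + 2)   ≡⟨ cong (2 * T +_) (sym (n^2≡n*n (j + 2))) ⟩
    2 * T + (j + 2) ^ 2         ∎

RepCond⇔¬Cond : ∀ {a} .{{_ : NonZero a}} k j → k + j ≡ a →
  RepCond a (k ^ 2 % a) (k ^ 2 / a) ⇔ (¬ Cond a j)
RepCond⇔¬Cond {a} k j k+j≡a = mk⇔
  (excludes ∘ subst (λ r → RepCond a r T) (square-complement-% k j k+j≡a))
  (subst (λ r → RepCond a r T) (sym (square-complement-% k j k+j≡a)) ∘ decides)
  where
  ρ T : ℕ
  ρ = j ^ 2 % a
  T = k ^ 2 / a
  identities : (lam a j + 2) * (a + 2) + ρ ≡ 2 * T + (j + 2) ^ 2 ×
               (lam a j + 1) * (a + 2) + (ρ + a + 2) ≡ 2 * T + (j + 2) ^ 2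
  identities = cond-identities a j ρ (lam a j) T
    (m≡m%n+[m/n]*n (j ^ 2) a) (square-complement-/ k j k+j≡a)
  bound₁ : (lam a j + 2) * (a + 2) < (j + 2) ^ 2 ⇔ 2 * T < ρ
  bound₁ = +-cross-< (proj₁ identities)
  bound₂ : (lam a j + 1) * (a + 2) < (j + 2) ^ 2 ⇔ 2 * T < ρ + a + 2
  bound₂ = +-cross-< (proj₂ identities)
  excludes : RepCond a ρ T → ¬ Cond a j
  excludes (inj₁ (_ , ρ≤2T))      (inj₁ (_ , c))      = <⇒≱ (Equivalence.to bound₁ c) ρ≤2T
  excludes (inj₁ (ρ-even , _))    (inj₂ (ρ-odd , _))  = 0≢1+n (trans (sym ρ-even) ρ-odd)
  excludes (inj₂ (ρ-odd , _))     (inj₁ (ρ-even , _)) = 0≢1+n (trans (sym ρ-even) ρ-odd)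
  excludes (inj₂ (_ , ρ+a+2≤2T)) (inj₂ (_ , c))      = <⇒≱ (Equivalence.to bound₂ c) ρ+a+2≤2T
  decides : ¬ Cond a j → RepCond a ρ T
  decides ¬cond with m%2≡0⊎m%2≡1 ρ
  ... | inj₁ ρ-even = inj₁ (ρ-even , ≮⇒≥ λ lt → ¬cond (inj₁ (ρ-even , Equivalence.from bound₁ lt)))
  ... | inj₂ ρ-odd  = inj₂ (ρ-odd , ≮⇒≥ λ lt → ¬cond (inj₂ (ρ-odd , Equivalence.from bound₂ lt)))

Rep[k²]⇔¬Cond : ∀ {a} .{{_ : NonZero a}} → a % 2 ≡ 1 →
  ∀ k j → k + j ≡ a → Rep a (a + 2) (k ^ 2) ⇔ (¬ Cond a j)
Rep[k²]⇔¬Cond a-odd k j k+j≡a = ⇔.trans (Rep⇔RepCond a-odd (k ^ 2)) (RepCond⇔¬Cond k j k+j≡a)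

corollary9 : (a : ℕ) → .{{_ : NonZero a}} → a % 2 ≡ 1 →
    (j₁ : ℕ) → IsJ1 a j₁ → IsSquareFrobenius a (a + 2) ((a ∸ j₁) ^ 2)
corollary9 a a-odd j₁ (_ , j₁<a , cond-j₁ , ¬cond-below-j₁) =
  (a ∸ j₁ , refl) ,
  (λ rep → Equivalence.to (Rep[k²]⇔¬Cond a-odd (a ∸ j₁) j₁ (m∸n+n≡m (<⇒≤ j₁<a))) rep cond-j₁) ,
  larger-squares
  where
  larger-squares : ∀ k → (a ∸ j₁) ^ 2 < k ^ 2 → Rep a (a + 2) (k ^ 2)
  larger-squares k k₁²<k² with a ≤? k
  ... | yes a≤k = a≤k⇒Rep[k²] a-odd a≤k
  ... | no a≰k  = Equivalence.from (Rep[k²]⇔¬Cond a-odd k (a ∸ k) (m+[n∸m]≡n k≤a))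
                    (¬cond-below-j₁ (a ∸ k) (m<n⇒0<n∸m k<a) a∸k<j₁)
    where
    open ≤-Reasoning
    k<a : k < a
    k<a = ≰⇒> a≰k
    k≤a : k ≤ a
    k≤a = <⇒≤ k<a
    a∸j₁<k : a ∸ j₁ < k
    a∸j₁<k = ≰⇒> λ k≤a∸j₁ → <⇒≱ k₁²<k² (^-monoˡ-≤ 2 k≤a∸j₁)
    a∸k<j₁ : a ∸ k < j₁
    a∸k<j₁ = begin-strict
      a ∸ k         <⟨ ∸-monoʳ-< a∸j₁<k k≤a ⟩
      a ∸ (a ∸ j₁)  ≡⟨ m∸[m∸n]≡n (<⇒≤ j₁<a) ⟩
      j₁            ∎
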